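{- Let $m\equiv 2\pmod 4$ with $m\ge 6$, and let $C_m$ be the cycle with vertices $v_1,\ldots,v_m$ and edges $\{v_1,v_2\},\ldots,\{v_{m-1},v_m\},\{v_m,v_1\}$. Define $a(v_i)=(i-1)/2$ for $i$ odd; $a(v_i)=m+1-i/2$ for $i$ even with $i\le m/2$; $a(v_i)=m-i/2$ for $i$ even with $i>m/2$. Let $D$ be the digraph obtained from $C_m$ by orienting every edge towards its endpoint with the larger $a$-value, except that the edge $\{v_m,v_1\}$ is oriented from $v_m$ to $v_1$. Then $a$ is an oriented $\beta$-valuation of $D$.
   Context: For a digraph with $n$ arcs, an oriented $\beta$-valuation is an injective map $b:V\to\{0,\ldots,n\}$ such that the multiset $\{b(v)-b(u)\bmod (n+1):(u,v)\text{ an arc}\}$ equals $\mathbb{Z}_{n+1}\setminus\{0\}$. Here $n=m$. -}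

module Defs where

open import Data.Nat using (ℕ; zero; suc; _+_; _*_; _∸_; _≤_; _<ᵇ_; _≤ᵇ_; _≡ᵇ_)
open import Data.Nat.DivMod using (_/_; _%_; _mod_)
open import Data.Fin using (Fin; toℕ)
open import Data.List using (List; []; map; length; upTo; allFin)
open import Data.List.Relation.Binary.Permutation.Propositional using (_↭_)
open import Data.Product using (_×_; _,_)
open import Data.Bool using (if_then_else_)
open import Function.Definitions using (Injective)
open import Relation.Binary.PropositionalEquality using (_≡_)

-- A digraph on vertex set Fin k is given by its list of arcs (u , v), i.e. u → v.
-- Number of arcs n = length of the list.

-- difference b(v) - b(u) mod (n+1), for b(u) ≤ n
diffMod : (n bu bv : ℕ) → ℕ
diffMod n bu bv = (bv + suc n ∸ bu) % suc n

IsOrientedBetaValuation : {k : ℕ} → List (Fin k × Fin k) → (Fin k → ℕ) → Set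
IsOrientedBetaValuation arcs b =
  Injective _≡_ _≡_ b
  × (∀ v → b v ≤ length arcs)
  × (map (λ { (u , v) → diffMod (length arcs) (b u) (b v) }) arcs
       ↭ map suc (upTo (length arcs)))

-- The labelling a(v_i), for 1-indexed i.
aLabel : (m i : ℕ) → ℕ
aLabel m i =
  if i % 2 ≡ᵇ 1 then (i ∸ 1) / 2
  else (if 2 * i ≤ᵇ m then m + 1 ∸ i / 2 else m ∸ i / 2)

-- Vertex v_i of C_m is represented by the index i-1 : Fin m.
aV : (m : ℕ) → Fin m → ℕ
aV m j = aLabel m (suc (toℕ j))

D : (m : ℕ) → List (Fin m × Fin m)
D zero = []
D (suc k) = map arc (allFin (suc k))
  where
  arc : Fin (suc k) → Fin (suc k) × Fin (suc k)
  arc j =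
    let j' = suc (toℕ j) mod suc k in
    if suc (toℕ j) ≡ᵇ suc k then (j , j')
    else (if aV (suc k) j <ᵇ aV (suc k) j' then (j , j') else (j' , j))

{-# OPTIONS --safe #-}
module Submission where

-- Write m = 4q + 2 = 2r + 2 and number the vertices from 0, vertex x being v_{x+1}.
-- Vertex 2p has label p ≤ r and vertex 2p+1 has label m - p - [q ≤ p] > r, so a is
-- injective. Every edge of the path v_1 … v_m joins an even and an odd vertex and is
-- oriented towards the larger label, so its arc difference is the absolute difference
-- of the labels: m - x for the edge leaving vertex x < r and m - x - 1 for r ≤ x ≤ 2r,
-- i.e. the values m, …, m - r + 1, m - r - 1, …, 1.
-- The closing arc v_m → v_1 goes from label r + 1 to label 0 and contributes
-- (0 - (r + 1)) mod (m + 1) = m - r, the one value missing.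

open import Defs
open import Data.Nat
  using (ℕ; zero; suc; _+_; _*_; _∸_; _≤_; _<_; _≤?_; ∣_-_∣; _<ᵇ_; _≤ᵇ_; _≡ᵇ_; z<s; s≤s; s<s; s≤s⁻¹)
open import Data.Nat.DivMod
  using (_%_; _/_; _mod_; m*n%n≡0; [m+kn]%n≡m%n; m*n/n≡m; [m+n]%n≡m%n; m≤n⇒m%n≡m; m<n⇒m%n≡m;
         n%n≡0; m≡m%n+[m/n]*n)
open import Data.Nat.Properties
open import Data.Bool using (true; false; T; if_then_else_)
open import Data.Unit using (tt)
open import Data.Fin as Fin using (Fin; toℕ; inject₁; fromℕ)
open import Data.Fin.Properties
  using (toℕ-fromℕ<; toℕ<n; toℕ-injective; toℕ-inject₁; toℕ-inject₁-≢; toℕ-fromℕ)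
open import Data.Product using (_×_; _,_)
open import Data.List using (_∷_; _++_; _∷ʳ_; map; length; applyUpTo; upTo; tabulate; allFin)
open import Data.List.Properties
  using (length-map; length-tabulate; map-∘; map-tabulate; applyUpTo-∷ʳ; map-upTo)
open import Data.List.Relation.Binary.Permutation.Propositional
  using (_↭_; ↭-refl; ↭-sym; prep; module PermutationReasoning)
open import Data.List.Relation.Binary.Permutation.Propositional.Properties using (∷↭∷ʳ)
open import Function using (_∘_; id)
open import Relation.Nullary using (¬_; yes; no; contradiction)
open import Relation.Nullary.Reflects using (ofʸ; ofⁿ)
open import Relation.Binary.PropositionalEquality
  using (_≡_; ≢-sym; refl; sym; trans; cong; cong₂; subst; module ≡-Reasoning)

if-true : ∀ {A : Set} {b} {x y : A} → T b → (if b then x else y) ≡ x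
if-true {b = true} _ = refl

if-false : ∀ {A : Set} {b} {x y : A} → ¬ T b → (if b then x else y) ≡ y
if-false {b = false} _  = refl
if-false {b = true}  ¬t = contradiction tt ¬t

tabulate-∷ʳ : ∀ {A : Set} {n} (f : Fin (suc n) → A) →
  tabulate f ≡ tabulate (f ∘ inject₁) ∷ʳ f (fromℕ n)
tabulate-∷ʳ {n = zero}  f = refl
tabulate-∷ʳ {n = suc n} f = cong (f Fin.zero ∷_) (tabulate-∷ʳ (f ∘ Fin.suc))

tabulate-applyUpTo : ∀ {A : Set} {n} {f : Fin n → A} {g : ℕ → A} →
  (∀ i → f i ≡ g (toℕ i)) → tabulate f ≡ applyUpTo g n
tabulate-applyUpTo {n = zero}  _   = refl
tabulate-applyUpTo {n = suc n} f≗g = cong₂ _∷_ (f≗g Fin.zero) (tabulate-applyUpTo (f≗g ∘ Fin.suc))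

applyUpTo-++ : ∀ {A : Set} (f : ℕ → A) a b →
  applyUpTo f (a + b) ≡ applyUpTo f a ++ applyUpTo (f ∘ (a +_)) b
applyUpTo-++ f zero    b = refl
applyUpTo-++ f (suc a) b = cong (f 0 ∷_) (applyUpTo-++ (f ∘ suc) a b)

applyUpTo-cong : ∀ {A : Set} {f g : ℕ → A} n →
  (∀ {x} → x < n → f x ≡ g x) → applyUpTo f n ≡ applyUpTo g n
applyUpTo-cong zero    f≗g = refl
applyUpTo-cong (suc n) f≗g = cong₂ _∷_ (f≗g z<s) (applyUpTo-cong n (f≗g ∘ s<s))

applyUpTo-rotate : ∀ {A : Set} (f : ℕ → A) a b →
  (applyUpTo f a ++ applyUpTo (λ i → f (suc (a + i))) b) ∷ʳ f a ↭ applyUpTo f (a + suc b)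
applyUpTo-rotate f zero    b = ↭-sym (∷↭∷ʳ (f 0) (applyUpTo (f ∘ suc) b))
applyUpTo-rotate f (suc a) b = prep (f 0) (applyUpTo-rotate (f ∘ suc) a b)

applyUpTo-n∸↭applyUpTo-suc : ∀ n → applyUpTo (n ∸_) n ↭ applyUpTo suc n
applyUpTo-n∸↭applyUpTo-suc zero    = ↭-refl
applyUpTo-n∸↭applyUpTo-suc (suc n) = begin
  suc n ∷ applyUpTo (n ∸_) n  ↭⟨ prep (suc n) (applyUpTo-n∸↭applyUpTo-suc n) ⟩
  suc n ∷ applyUpTo suc n     ↭⟨ ∷↭∷ʳ (suc n) (applyUpTo suc n) ⟩
  applyUpTo suc n ∷ʳ suc n    ≡⟨ applyUpTo-∷ʳ suc n ⟩
  applyUpTo suc (suc n)       ∎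
  where open PermutationReasoning

data EvenOdd : ℕ → Set where
  even : ∀ p → EvenOdd (p + p)
  odd  : ∀ p → EvenOdd (suc (p + p))

double-suc : ∀ n → suc n + suc n ≡ 2 + (n + n)
double-suc n = cong suc (+-suc n n)

evenOdd : ∀ n → EvenOdd n
evenOdd zero = even 0
evenOdd (suc n) with evenOdd n
... | even p = odd p
... | odd p  = subst EvenOdd (double-suc p) (even (suc p))

2*n≡n+n : ∀ n → 2 * n ≡ n + n
2*n≡n+n n = cong (n +_) (+-identityʳ n)

n+n≡n*2 : ∀ n → n + n ≡ n * 2
n+n≡n*2 n = trans (sym (2*n≡n+n n)) (*-comm 2 n)

n*4≡[n+n]+[n+n] : ∀ n → n * 4 ≡ (n + n) + (n + n)
n*4≡[n+n]+[n+n] n = trans (*-distribˡ-+ n 2 2) (cong₂ _+_ (sym (n+n≡n*2 n)) (sym (n+n≡n*2 n)))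

[n+n]%2≡0 : ∀ n → (n + n) % 2 ≡ 0
[n+n]%2≡0 n = trans (cong (_% 2) (n+n≡n*2 n)) (m*n%n≡0 n 2)

[1+n+n]%2≡1 : ∀ n → suc (n + n) % 2 ≡ 1
[1+n+n]%2≡1 n = trans (cong (_% 2) (cong suc (n+n≡n*2 n))) ([m+kn]%n≡m%n 1 n 2)

[n+n]/2≡n : ∀ n → (n + n) / 2 ≡ n
[n+n]/2≡n n = trans (cong (_/ 2) (n+n≡n*2 n)) (m*n/n≡m n 2)

n+n<m+m⇒n<m : ∀ {m n} → n + n < m + m → n < m
n+n<m+m⇒n<m n+n<m+m = ≰⇒> (λ m≤n → <⇒≱ n+n<m+m (+-mono-≤ m≤n m≤n))

m+m≤1+n+n⇒m≤n : ∀ {m n} → m + m ≤ suc (n + n) → m ≤ n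
m+m≤1+n+n⇒m≤n {m} {n} m+m≤1+n+n = ≮⇒≥ λ n<m → 1+n≰n (begin
  2 + (n + n)    ≡⟨ double-suc n ⟨
  suc n + suc n  ≤⟨ +-mono-≤ n<m n<m ⟩
  m + m          ≤⟨ m+m≤1+n+n ⟩
  suc (n + n)    ∎)
  where open ≤-Reasoning

∣n∸a-b∣≡n∸[a+b] : ∀ n a b → a + b ≤ n → ∣ n ∸ a - b ∣ ≡ n ∸ (a + b)
∣n∸a-b∣≡n∸[a+b] n a b a+b≤n =
  trans (m≤n⇒∣n-m∣≡n∸m (m+n≤o⇒m≤o∸n b (subst (_≤ n) (+-comm a b) a+b≤n))) (∸-+-assoc n a b)

diffMod-≤ : ∀ {n a b} → a ≤ b → b ≤ n → diffMod n a b ≡ b ∸ a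
diffMod-≤ {n} {a} {b} a≤b b≤n = begin
  (b + suc n ∸ a) % suc n  ≡⟨ cong (_% suc n) (+-∸-comm (suc n) a≤b) ⟩
  (b ∸ a + suc n) % suc n  ≡⟨ [m+n]%n≡m%n (b ∸ a) (suc n) ⟩
  (b ∸ a) % suc n          ≡⟨ m≤n⇒m%n≡m (≤-trans (m∸n≤m b a) b≤n) ⟩
  b ∸ a                    ∎
  where open ≡-Reasoning

aLabel-odd : ∀ m p → aLabel m (suc (p + p)) ≡ p
aLabel-odd m p = trans (if-true (≡⇒≡ᵇ _ 1 ([1+n+n]%2≡1 p))) ([n+n]/2≡n p)

aLabel-even : ∀ m p →
  aLabel m (2 + (p + p)) ≡ (if 2 * (2 + (p + p)) ≤ᵇ m then m ∸ p else m ∸ suc p)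
aLabel-even m p = trans (if-false not-odd) (cong₂ (if 2 * (2 + (p + p)) ≤ᵇ m then_else_)
  (cong₂ _∸_ (+-comm m 1) half) (cong (m ∸_) half))
  where
  half : (2 + (p + p)) / 2 ≡ suc p
  half = trans (cong (_/ 2) (sym (double-suc p))) ([n+n]/2≡n (suc p))
  even-index : (2 + (p + p)) % 2 ≡ 0
  even-index = trans (cong (_% 2) (sym (double-suc p))) ([n+n]%2≡0 (suc p))
  not-odd : ¬ T ((2 + (p + p)) % 2 ≡ᵇ 1)
  not-odd = subst (λ z → ¬ T (z ≡ᵇ 1)) (sym even-index) (λ ())

aLabel-even-≤ : ∀ m p → 2 * (2 + (p + p)) ≤ m → aLabel m (2 + (p + p)) ≡ m ∸ p
aLabel-even-≤ m p small = trans (aLabel-even m p) (if-true (≤⇒≤ᵇ small))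

aLabel-even-> : ∀ m p → m < 2 * (2 + (p + p)) → aLabel m (2 + (p + p)) ≡ m ∸ suc p
aLabel-even-> m p large =
  trans (aLabel-even m p) (if-false (λ small → <⇒≱ large (≤ᵇ⇒≤ _ m small)))

aLabel-≤ : ∀ m x → x < m → aLabel m (suc x) ≤ m
aLabel-≤ m x x<m with evenOdd x
... | even p = begin
  aLabel m (suc (p + p))  ≡⟨ aLabel-odd m p ⟩
  p                       ≤⟨ m≤m+n p p ⟩
  p + p                   <⟨ x<m ⟩
  m                       ∎
  where open ≤-Reasoning
... | odd p with 2 * (2 + (p + p)) ≤? m
...   | yes small = subst (_≤ m) (sym (aLabel-even-≤ m p small)) (m∸n≤m m p)
...   | no ¬small = subst (_≤ m) (sym (aLabel-even-> m p (≰⇒> ¬small))) (m∸n≤m m (suc p))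

aV-≤ : ∀ {m} (j : Fin m) → aV m j ≤ m
aV-≤ j = aLabel-≤ _ (toℕ j) (toℕ<n j)

-- With n = length arcs, arcDiff n b is definitionally the function mapped over the
-- arcs in IsOrientedBetaValuation.
arcDiff : ∀ {k} → ℕ → (Fin k → ℕ) → Fin k × Fin k → ℕ
arcDiff n b (u , v) = diffMod n (b u) (b v)

arcDiff-towardsLarger : ∀ {k n} (b : Fin k → ℕ) (u v : Fin k) → b u ≤ n → b v ≤ n →
  arcDiff n b (if b u <ᵇ b v then (u , v) else (v , u)) ≡ ∣ b u - b v ∣
arcDiff-towardsLarger b u v bu≤n bv≤n with b u <ᵇ b v | <ᵇ-reflects-< (b u) (b v)
... | true  | ofʸ bu<bv = trans (diffMod-≤ (<⇒≤ bu<bv) bv≤n) (sym (m≤n⇒∣m-n∣≡n∸m (<⇒≤ bu<bv)))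
... | false | ofⁿ bu≮bv = trans (diffMod-≤ (≮⇒≥ bu≮bv) bu≤n) (sym (m≤n⇒∣n-m∣≡n∸m (≮⇒≥ bu≮bv)))

cyclicSuc : ∀ {k} → Fin (suc k) → Fin (suc k)
cyclicSuc {k} j = suc (toℕ j) mod suc k

-- The arc placed by D on the edge {v_{j+1}, v_{j+2}}: D (suc k) unfolds to
-- map (arc k) (allFin (suc k)), but the copy in D is local to its where-clause.
arc : (k : ℕ) → Fin (suc k) → Fin (suc k) × Fin (suc k)
arc k j =
  if suc (toℕ j) ≡ᵇ suc k then (j , cyclicSuc j)
  else (if aV (suc k) j <ᵇ aV (suc k) (cyclicSuc j) then (j , cyclicSuc j) else (cyclicSuc j , j))

length-D : ∀ m → length (D m) ≡ m
length-D zero    = refl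
length-D (suc k) = trans (length-map (arc k) (allFin (suc k))) (length-tabulate id)

pathDiff : ℕ → ℕ → ℕ
pathDiff m x = ∣ aLabel m (suc x) - aLabel m (2 + x) ∣

toℕ-cyclicSuc : ∀ {k} (j : Fin (suc k)) → toℕ (cyclicSuc j) ≡ suc (toℕ j) % suc k
toℕ-cyclicSuc j = toℕ-fromℕ< _

cyclicSuc-inject₁ : ∀ {k} (i : Fin k) → cyclicSuc (inject₁ i) ≡ Fin.suc i
cyclicSuc-inject₁ {k} i = toℕ-injective (begin
  toℕ (cyclicSuc (inject₁ i))    ≡⟨ toℕ-cyclicSuc (inject₁ i) ⟩
  suc (toℕ (inject₁ i)) % suc k  ≡⟨ cong (λ x → suc x % suc k) (toℕ-inject₁ i) ⟩
  suc (toℕ i) % suc k            ≡⟨ m<n⇒m%n≡m (s<s (toℕ<n i)) ⟩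
  suc (toℕ i)                    ∎)
  where open ≡-Reasoning

cyclicSuc-fromℕ : ∀ k → cyclicSuc (fromℕ k) ≡ Fin.zero
cyclicSuc-fromℕ k = toℕ-injective (begin
  toℕ (cyclicSuc (fromℕ k))    ≡⟨ toℕ-cyclicSuc (fromℕ k) ⟩
  suc (toℕ (fromℕ k)) % suc k  ≡⟨ cong (λ x → suc x % suc k) (toℕ-fromℕ k) ⟩
  suc k % suc k                ≡⟨ n%n≡0 (suc k) ⟩
  0                            ∎)
  where open ≡-Reasoning

arcDiff-arc-inject₁ : ∀ k (i : Fin k) →
  arcDiff (suc k) (aV (suc k)) (arc k (inject₁ i)) ≡ pathDiff (suc k) (toℕ i)
arcDiff-arc-inject₁ k i = begin
  δ (arc k j)
    ≡⟨ cong δ (if-false (λ last → toℕ-inject₁-≢ i (sym (≡ᵇ⇒≡ (toℕ j) k last)))) ⟩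
  δ (if aV m j <ᵇ aV m (cyclicSuc j) then (j , cyclicSuc j) else (cyclicSuc j , j))
    ≡⟨ arcDiff-towardsLarger (aV m) j (cyclicSuc j) (aV-≤ j) (aV-≤ (cyclicSuc j)) ⟩
  ∣ aV m j - aV m (cyclicSuc j) ∣
    ≡⟨ cong₂ ∣_-_∣ (cong (aLabel m ∘ suc) (toℕ-inject₁ i)) (cong (aV m) (cyclicSuc-inject₁ i)) ⟩
  pathDiff m (toℕ i) ∎
  where
  open ≡-Reasoning
  m : ℕ
  m = suc k
  δ : Fin m × Fin m → ℕ
  δ = arcDiff m (aV m)
  j : Fin m
  j = inject₁ i

arcDiff-arc-fromℕ : ∀ k →
  arcDiff (suc k) (aV (suc k)) (arc k (fromℕ k)) ≡ diffMod (suc k) (aLabel (suc k) (suc k)) 0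
arcDiff-arc-fromℕ k = begin
  δ (arc k (fromℕ k))                ≡⟨ cong δ (if-true (≡⇒≡ᵇ _ _ (cong suc (toℕ-fromℕ k)))) ⟩
  δ (fromℕ k , cyclicSuc (fromℕ k))
    ≡⟨ cong₂ (λ a v → diffMod m a (aV m v)) (cong (aLabel m ∘ suc) (toℕ-fromℕ k)) (cyclicSuc-fromℕ k) ⟩
  diffMod m (aLabel m m) 0           ∎
  where
  open ≡-Reasoning
  m : ℕ
  m = suc k
  δ : Fin m × Fin m → ℕ
  δ = arcDiff m (aV m)

map-arcDiff-D : ∀ k → map (arcDiff (suc k) (aV (suc k))) (D (suc k))
  ≡ applyUpTo (pathDiff (suc k)) k ∷ʳ diffMod (suc k) (aLabel (suc k) (suc k)) 0
map-arcDiff-D k = begin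
  map δ (map (arc k) (allFin (suc k)))  ≡⟨ map-∘ (allFin (suc k)) ⟨
  map (δ ∘ arc k) (tabulate id)         ≡⟨ map-tabulate id (δ ∘ arc k) ⟩
  tabulate (δ ∘ arc k)                  ≡⟨ tabulate-∷ʳ (δ ∘ arc k) ⟩
  tabulate (δ ∘ arc k ∘ inject₁) ∷ʳ δ (arc k (fromℕ k))
    ≡⟨ cong₂ _∷ʳ_ (tabulate-applyUpTo (arcDiff-arc-inject₁ k)) (arcDiff-arc-fromℕ k) ⟩
  applyUpTo (pathDiff (suc k)) k ∷ʳ diffMod (suc k) (aLabel (suc k) (suc k)) 0 ∎
  where
  open ≡-Reasoning
  δ : Fin (suc k) × Fin (suc k) → ℕ
  δ = arcDiff (suc k) (aV (suc k))

pathDiff-even : ∀ m p c → aLabel m (2 + (p + p)) ≡ m ∸ c → c + p ≤ m →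
  pathDiff m (p + p) ≡ m ∸ (c + p)
pathDiff-even m p c label≡ c+p≤m = begin
  ∣ aLabel m (suc (p + p)) - aLabel m (2 + (p + p)) ∣  ≡⟨ cong₂ ∣_-_∣ (aLabel-odd m p) label≡ ⟩
  ∣ p - (m ∸ c) ∣                                      ≡⟨ ∣-∣-comm p (m ∸ c) ⟩
  ∣ m ∸ c - p ∣                                        ≡⟨ ∣n∸a-b∣≡n∸[a+b] m c p c+p≤m ⟩
  m ∸ (c + p)                                          ∎
  where open ≡-Reasoning

pathDiff-odd : ∀ m p c → aLabel m (2 + (p + p)) ≡ m ∸ c → suc (c + p) ≤ m →
  pathDiff m (suc (p + p)) ≡ m ∸ suc (c + p)
pathDiff-odd m p c label≡ c+p<m = begin
  ∣ aLabel m (2 + (p + p)) - aLabel m (3 + (p + p)) ∣  ≡⟨ cong₂ ∣_-_∣ label≡ next-label ⟩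
  ∣ m ∸ c - suc p ∣                                    ≡⟨ ∣n∸a-b∣≡n∸[a+b] m c (suc p) c+1+p≤m ⟩
  m ∸ (c + suc p)                                      ≡⟨ cong (m ∸_) (+-suc c p) ⟩
  m ∸ suc (c + p)                                      ∎
  where
  open ≡-Reasoning
  next-label : aLabel m (3 + (p + p)) ≡ suc p
  next-label = trans (cong (aLabel m ∘ suc) (sym (double-suc p))) (aLabel-odd m (suc p))
  c+1+p≤m : c + suc p ≤ m
  c+1+p≤m = subst (_≤ m) (sym (+-suc c p)) c+p<m

module Cycle (q : ℕ) where

  r : ℕ
  r = q + q

  -- m = 4q + 2, written as a successor so that D m unfolds.
  m : ℕ
  m = 2 + (r + r)

  1+r≤m : suc r ≤ m
  1+r≤m = s≤s (m≤n⇒m≤1+n (m≤m+n r r))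

  m∸[1+r]≡1+r : m ∸ suc r ≡ suc r
  m∸[1+r]≡1+r = m+n∸n≡m (suc r) r

  aLabel-even-low : ∀ p → p < q → aLabel m (2 + (p + p)) ≡ m ∸ p
  aLabel-even-low p p<q = aLabel-even-≤ m p (begin
    2 * (2 + (p + p))    ≡⟨ cong (2 *_) (double-suc p) ⟨
    2 * (suc p + suc p)  ≤⟨ *-monoʳ-≤ 2 (+-mono-≤ p<q p<q) ⟩
    2 * r                ≡⟨ 2*n≡n+n r ⟩
    r + r                ≤⟨ m≤n+m (r + r) 2 ⟩
    m                    ∎)
    where open ≤-Reasoning

  aLabel-even-high : ∀ p → q ≤ p → aLabel m (2 + (p + p)) ≡ m ∸ suc p
  aLabel-even-high p q≤p = aLabel-even-> m p (begin-strict
    m                  <⟨ n≤1+n (suc m) ⟩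
    2 + m              ≡⟨ cong (4 +_) (2*n≡n+n r) ⟨
    2 * 2 + 2 * r      ≡⟨ *-distribˡ-+ 2 2 r ⟨
    2 * (2 + r)        ≤⟨ *-monoʳ-≤ 2 (+-monoʳ-≤ 2 (+-mono-≤ q≤p q≤p)) ⟩
    2 * (2 + (p + p))  ∎)
    where open ≤-Reasoning

  pathDiff-low : ∀ {x} → x < r → pathDiff m x ≡ m ∸ x
  pathDiff-low {x} x<r with evenOdd x
  ... | even p = pathDiff-even m p p (aLabel-even-low p (n+n<m+m⇒n<m x<r))
                   (≤-trans (m≤n⇒m≤1+n (<⇒≤ x<r)) 1+r≤m)
  ... | odd p  = pathDiff-odd m p p (aLabel-even-low p (n+n<m+m⇒n<m (<-trans (n<1+n (p + p)) x<r)))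
                   (≤-trans (m≤n⇒m≤1+n (<⇒≤ x<r)) 1+r≤m)

  pathDiff-high : ∀ {x} → r ≤ x → x ≤ r + r → pathDiff m x ≡ m ∸ suc x
  pathDiff-high {x} r≤x x≤r+r with evenOdd x
  ... | even p = pathDiff-even m p (suc p) (aLabel-even-high p (m+m≤1+n+n⇒m≤n (m≤n⇒m≤1+n r≤x)))
                   (s≤s (m≤n⇒m≤1+n x≤r+r))
  ... | odd p  = pathDiff-odd m p (suc p) (aLabel-even-high p (m+m≤1+n+n⇒m≤n r≤x))
                   (s≤s (m≤n⇒m≤1+n x≤r+r))

  applyUpTo-pathDiff : applyUpTo (pathDiff m) (suc (r + r))
            ≡ applyUpTo (m ∸_) r ++ applyUpTo (λ i → m ∸ suc (r + i)) (suc r)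
  applyUpTo-pathDiff = begin
    applyUpTo (pathDiff m) (suc (r + r))  ≡⟨ cong (applyUpTo (pathDiff m)) (+-suc r r) ⟨
    applyUpTo (pathDiff m) (r + suc r)    ≡⟨ applyUpTo-++ (pathDiff m) r (suc r) ⟩
    applyUpTo (pathDiff m) r ++ applyUpTo (pathDiff m ∘ (r +_)) (suc r)
      ≡⟨ cong₂ _++_ (applyUpTo-cong r pathDiff-low)
                    (applyUpTo-cong (suc r) λ i<1+r →
                      pathDiff-high (m≤m+n r _) (+-monoʳ-≤ r (s≤s⁻¹ i<1+r))) ⟩
    applyUpTo (m ∸_) r ++ applyUpTo (λ i → m ∸ suc (r + i)) (suc r) ∎
    where open ≡-Reasoning

  closingArcDiff : diffMod m (aLabel m m) 0 ≡ m ∸ r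
  closingArcDiff = begin
    diffMod m (aLabel m m) 0  ≡⟨ cong (λ a → diffMod m a 0) (aLabel-even-high r (m≤m+n q q)) ⟩
    diffMod m (m ∸ suc r) 0   ≡⟨ cong (λ a → diffMod m a 0) m∸[1+r]≡1+r ⟩
    diffMod m (suc r) 0       ≡⟨ m≤n⇒m%n≡m (m∸n≤m m r) ⟩
    m ∸ r                     ∎
    where open ≡-Reasoning

  map-arcDiff-D-↭ : map (arcDiff m (aV m)) (D m) ↭ map suc (upTo m)
  map-arcDiff-D-↭ = begin
    map (arcDiff m (aV m)) (D m)
      ≡⟨ map-arcDiff-D (suc (r + r)) ⟩
    applyUpTo (pathDiff m) (suc (r + r)) ∷ʳ diffMod m (aLabel m m) 0
      ≡⟨ cong₂ _∷ʳ_ applyUpTo-pathDiff closingArcDiff ⟩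
    (applyUpTo (m ∸_) r ++ applyUpTo (λ i → m ∸ suc (r + i)) (suc r)) ∷ʳ (m ∸ r)
      ↭⟨ applyUpTo-rotate (m ∸_) r (suc r) ⟩
    applyUpTo (m ∸_) (r + suc (suc r))
      ≡⟨ cong (applyUpTo (m ∸_)) (trans (+-suc r (suc r)) (cong suc (+-suc r r))) ⟩
    applyUpTo (m ∸_) m
      ↭⟨ applyUpTo-n∸↭applyUpTo-suc m ⟩
    applyUpTo suc m
      ≡⟨ map-upTo suc m ⟨
    map suc (upTo m) ∎
    where open PermutationReasoning

  offset : ℕ → ℕ
  offset p = if p <ᵇ q then p else suc p

  offset-≤ : ∀ p → offset p ≤ suc p
  offset-≤ p with p <ᵇ q
  ... | true  = n≤1+n p
  ... | false = ≤-refl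

  offset-injective : ∀ {p p′} → offset p ≡ offset p′ → p ≡ p′
  offset-injective {p} {p′} with p <ᵇ q | <ᵇ-reflects-< p q | p′ <ᵇ q | <ᵇ-reflects-< p′ q
  ... | true  | _       | true  | _        = id
  ... | false | _       | false | _        = suc-injective
  ... | true  | ofʸ p<q | false | ofⁿ p′≮q = λ p≡1+p′ →
      contradiction p≡1+p′ (<⇒≢ (<-≤-trans p<q (m≤n⇒m≤1+n (≮⇒≥ p′≮q))))
  ... | false | ofⁿ p≮q | true  | ofʸ p′<q = λ 1+p≡p′ →
      contradiction (sym 1+p≡p′) (<⇒≢ (<-≤-trans p′<q (m≤n⇒m≤1+n (≮⇒≥ p≮q))))

  aLabel-even-offset : ∀ p → aLabel m (2 + (p + p)) ≡ m ∸ offset p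
  aLabel-even-offset p with p <ᵇ q | <ᵇ-reflects-< p q
  ... | true  | ofʸ p<q = aLabel-even-low p p<q
  ... | false | ofⁿ p≮q = aLabel-even-high p (≮⇒≥ p≮q)

  r<aLabel-even : ∀ {p} → p ≤ r → r < aLabel m (2 + (p + p))
  r<aLabel-even {p} p≤r = begin-strict
    r                       <⟨ n<1+n r ⟩
    suc r                   ≡⟨ m∸[1+r]≡1+r ⟨
    m ∸ suc r               ≤⟨ ∸-monoʳ-≤ m (≤-trans (offset-≤ p) (s≤s p≤r)) ⟩
    m ∸ offset p            ≡⟨ aLabel-even-offset p ⟨
    aLabel m (2 + (p + p))  ∎
    where open ≤-Reasoning

  aLabel-even-injective : ∀ {p p′} → p ≤ r → p′ ≤ r →
    aLabel m (2 + (p + p)) ≡ aLabel m (2 + (p′ + p′)) → p ≡ p′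
  aLabel-even-injective {p} {p′} p≤r p′≤r label≡ = offset-injective
    (∸-cancelˡ-≡ (offset-≤m p p≤r) (offset-≤m p′ p′≤r)
      (trans (sym (aLabel-even-offset p)) (trans label≡ (aLabel-even-offset p′))))
    where
    offset-≤m : ∀ p → p ≤ r → offset p ≤ m
    offset-≤m p p≤r = ≤-trans (offset-≤ p) (≤-trans (s≤s p≤r) 1+r≤m)

  half-≤r : ∀ p → p + p < m → p ≤ r
  half-≤r p p+p<m = m+m≤1+n+n⇒m≤n (s≤s⁻¹ p+p<m)

  aLabel-odd<aLabel-even : ∀ p p′ → p + p < m → suc (p′ + p′) < m →
    aLabel m (suc (p + p)) < aLabel m (2 + (p′ + p′))
  aLabel-odd<aLabel-even p p′ p+p<m 1+p′+p′<m = begin-strict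
    aLabel m (suc (p + p))    ≡⟨ aLabel-odd m p ⟩
    p                         ≤⟨ half-≤r p p+p<m ⟩
    r                         <⟨ r<aLabel-even (half-≤r p′ (<-trans (n<1+n _) 1+p′+p′<m)) ⟩
    aLabel m (2 + (p′ + p′))  ∎
    where open ≤-Reasoning

  aLabel-injective : ∀ {x y} → x < m → y < m → aLabel m (suc x) ≡ aLabel m (suc y) → x ≡ y
  aLabel-injective {x} {y} x<m y<m label≡ with evenOdd x | evenOdd y
  ... | even p | even p′ =
    cong (λ z → z + z) (trans (sym (aLabel-odd m p)) (trans label≡ (aLabel-odd m p′)))
  ... | even p | odd p′  = contradiction label≡ (<⇒≢ (aLabel-odd<aLabel-even p p′ x<m y<m))
  ... | odd p  | even p′ = contradiction label≡ (≢-sym (<⇒≢ (aLabel-odd<aLabel-even p′ p y<m x<m)))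
  ... | odd p  | odd p′  = cong (λ z → suc (z + z)) (aLabel-even-injective
    (half-≤r p (<-trans (n<1+n _) x<m)) (half-≤r p′ (<-trans (n<1+n _) y<m)) label≡)

  isOrientedBetaValuation : IsOrientedBetaValuation (D m) (aV m)
  isOrientedBetaValuation =
      (λ {i} {j} → toℕ-injective ∘ aLabel-injective (toℕ<n i) (toℕ<n j))
    , (λ v → subst (aV m v ≤_) (sym (length-D m)) (aV-≤ v))
    , subst (λ n → map (arcDiff n (aV m)) (D m) ↭ map suc (upTo n)) (sym (length-D m))
            map-arcDiff-D-↭

-- The construction works for m = 2 as well.
proposition5p3 : (m : ℕ) → m % 4 ≡ 2 → 6 ≤ m → IsOrientedBetaValuation (D m) (aV m)
proposition5p3 m m%4≡2 _ =
  subst (λ n → IsOrientedBetaValuation (D n) (aV n)) (sym m≡2+4q) (Cycle.isOrientedBetaValuation q)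
  where
  open ≡-Reasoning
  q : ℕ
  q = m / 4
  m≡2+4q : m ≡ Cycle.m q
  m≡2+4q = begin
    m              ≡⟨ m≡m%n+[m/n]*n m 4 ⟩
    m % 4 + q * 4  ≡⟨ cong₂ _+_ m%4≡2 (n*4≡[n+n]+[n+n] q) ⟩
    Cycle.m q      ∎
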